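{- Let $f:\{0,1\}^n\to\{0,1\}$ with $F:=f^{ -1}(1)\neq\emptyset$, define $g_f(a)=1$ iff $\Pr_{x\sim F}[f(a\oplus x)=1]\ge 1/2$, $G:=g_f^{ -1}(1)$ and $\mathcal{X}=\{x\in G:\{y: y\preceq x\}\subseteq G\}$. If $G$ is a linear subspace of $\mathbb{F}_2^n$ and $g_f$ is not anti-monotone, then for every $x\in G\setminus\mathcal{X}$, $\Pr_{u\sim F,\ y}[f(y\oplus u)=0]\ge 1/4$, where $u$ is uniform on $F$ and, independently, $y$ is uniform on $\{y\in\{0,1\}^n:y\preceq x\}$.
   Context: $\{0,1\}^n$ is identified with $\mathbb{F}_2^n$, $\oplus$ is coordinatewise XOR, and $y\preceq x$ means $y_i\le x_i$ for all $i$. A function is anti-monotone if $h(y)\ge h(x)$ whenever $y\preceq x$. -}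

module Defs where

open import Data.Bool using (Bool; true; false; _xor_; _≤_)
open import Data.Bool.Properties using () renaming (_≤?_ to _≤ᵇ?_)
open import Data.Nat using (ℕ; zero; suc; _*_; _≤ᵇ_) renaming (_≤_ to _≤ℕ_)
open import Data.List using (List; []; _∷_; [_]; map; _++_; length; filterᵇ)
open import Data.Nat.ListAction using (sum)
open import Data.Vec using (Vec; []; _∷_; zipWith; replicate)
open import Data.Vec.Relation.Binary.Pointwise.Inductive using (Pointwise; decidable)
open import Data.Product using (Σ; _×_; ∃)
open import Relation.Nullary using (¬_; Dec; does)
open import Relation.Binary.PropositionalEquality using (_≡_)

Cube : ℕ → Set
Cube n = Vec Bool n

_⊕_ : ∀ {n} → Cube n → Cube n → Cube n
_⊕_ = zipWith _xor_

𝟎 : ∀ {n} → Cube n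
𝟎 = replicate _ false

_⪯_ : ∀ {n} → Cube n → Cube n → Set
y ⪯ x = Pointwise _≤_ y x

_⪯?_ : ∀ {n} (y x : Cube n) → Dec (y ⪯ x)
y ⪯? x = decidable _≤ᵇ?_ y x

allVecs : (n : ℕ) → List (Cube n)
allVecs zero = [ [] ]
allVecs (suc n) = map (false ∷_) (allVecs n) ++ map (true ∷_) (allVecs n)

count : ∀ {A : Set} → (A → Bool) → List A → ℕ
count p xs = length (filterᵇ p xs)

sizeF : ∀ {n} → (Cube n → Bool) → ℕ
sizeF {n} f = count f (allVecs n)

hits : ∀ {n} → (Cube n → Bool) → Cube n → ℕ
hits {n} f a = count (λ x → f x Data.Bool.∧ f (a ⊕ x)) (allVecs n)

-- g_f(a) = 1 iff Pr_{x∼F}[f(a⊕x)=1] ≥ 1/2, i.e. |F| ≤ 2·#{x∈F : f(a⊕x)=1}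
g : ∀ {n} → (Cube n → Bool) → Cube n → Bool
g f a = sizeF f ≤ᵇ 2 * hits f a

InG : ∀ {n} → (Cube n → Bool) → Cube n → Set
InG f a = g f a ≡ true

AntiMonotone : ∀ {n} → (Cube n → Bool) → Set
AntiMonotone {n} h = ∀ (x y : Cube n) → y ⪯ x → h x ≤ h y

-- S ⊆ 𝔽₂^n is a linear subspace (over 𝔽₂ scalar multiplication is trivial)
IsSubspace : ∀ {n} → (Cube n → Set) → Set
IsSubspace {n} S = S 𝟎 × (∀ (a b : Cube n) → S a → S b → S (a ⊕ b))

Inᵡ : ∀ {n} → (Cube n → Bool) → Cube n → Set
Inᵡ {n} f x = InG f x × (∀ (y : Cube n) → y ⪯ x → InG f y)

downSize : ∀ {n} → Cube n → ℕ
downSize {n} x = count (λ y → does (y ⪯? x)) (allVecs n)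

badPairs : ∀ {n} → (Cube n → Bool) → Cube n → ℕ
badPairs {n} f x =
  sum (map (λ u → count (λ y → does (y ⪯? x) Data.Bool.∧ Data.Bool.not (f (y ⊕ u))) (allVecs n))
           (filterᵇ f (allVecs n)))

-- Let D = {y : y ⪯ x}. Both D and G are closed under ⊕, and x ∉ 𝒳 yields some y₀ ∈ D ∖ G, so
-- z ↦ z ⊕ y₀ maps D ∩ G injectively into D ∖ G and |D ∖ G| ≥ |D|/2. For a ∉ G fewer than half
-- of the u ∈ F have f(a ⊕ u) = 1, so every y ∈ D ∖ G lies in more than |F|/2 pairs (u, y) with
-- f(y ⊕ u) = 0. Counting these pairs gives at least |F||D|/4 of them.

module Submission where

open import Defs
open import Data.Bool using (Bool; true; false; _∧_; not; _xor_)
import Data.Bool as Bool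
open import Data.Bool.Properties using (xor-assoc; xor-same; xor-identityˡ; xor-identityʳ; ≤-minimum; ¬-not; not-¬)
open import Data.List using (List; []; _∷_; map; _++_; filterᵇ)
open import Data.List.Properties using (map-++; map-∘; map-cong)
open import Data.List.Membership.Propositional using (_∈_; lose)
open import Data.List.Membership.Propositional.Properties using (∈-map⁺; ∈-++⁺ˡ; ∈-++⁺ʳ)
open import Data.List.Relation.Unary.Any using (here; any?; satisfied)
open import Data.Nat using (ℕ; zero; suc; _+_; _*_; _≤_; _<_; z≤n)
open import Data.Nat.ListAction using (sum)
open import Data.Nat.ListAction.Properties using (sum-++)
open import Data.Nat.Properties
open import Algebra.Properties.CommutativeSemigroup +-commutativeSemigroup using (interchange)
open import Algebra.Properties.CommutativeSemigroup *-commutativeSemigroup using (x∙yz≈y∙xz)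
open import Data.Product using (∃; _×_; _,_)
open import Data.Vec using ([]; _∷_)
open import Data.Vec.Properties using (zipWith-assoc; zipWith-identityˡ; zipWith-identityʳ)
open import Data.Vec.Relation.Binary.Pointwise.Inductive using ([]; _∷_)
open import Function using (_∘_)
open import Relation.Nullary using (¬_; yes; no; does; contradiction)
open import Relation.Nullary.Decidable using (dec-true; decidable-stable; ¬?; _→-dec_)
open import Relation.Unary using (Decidable)
open import Relation.Binary.PropositionalEquality

𝟙 : Bool → ℕ
𝟙 true = 1
𝟙 false = 0

𝟙-∧ : ∀ a b → 𝟙 (a ∧ b) ≡ 𝟙 a * 𝟙 b
𝟙-∧ true true = refl
𝟙-∧ true false = refl
𝟙-∧ false b = refl

𝟙-split : ∀ a b → 𝟙 a ≡ 𝟙 (a ∧ b) + 𝟙 (a ∧ not b)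
𝟙-split true true = refl
𝟙-split true false = refl
𝟙-split false b = refl

𝟙-mono : ∀ {a b} → (a ≡ true → b ≡ true) → 𝟙 a ≤ 𝟙 b
𝟙-mono {false} a⇒b = z≤n
𝟙-mono {true} a⇒b rewrite a⇒b refl = ≤-refl

∑ : {A : Set} → List A → (A → ℕ) → ℕ
∑ xs φ = sum (map φ xs)

syntax ∑ xs (λ x → e) = ∑[ x ∈ xs ] e

module _ {A : Set} where

  ∑-cong : ∀ {φ ψ : A → ℕ} xs → (∀ x → φ x ≡ ψ x) → ∑ xs φ ≡ ∑ xs ψ
  ∑-cong xs φ≗ψ = cong sum (map-cong φ≗ψ xs)

  ∑-mono : ∀ {φ ψ : A → ℕ} xs → (∀ x → φ x ≤ ψ x) → ∑ xs φ ≤ ∑ xs ψ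
  ∑-mono [] φ≤ψ = z≤n
  ∑-mono (x ∷ xs) φ≤ψ = +-mono-≤ (φ≤ψ x) (∑-mono xs φ≤ψ)

  ∑-++ : ∀ (φ : A → ℕ) xs ys → ∑ (xs ++ ys) φ ≡ ∑ xs φ + ∑ ys φ
  ∑-++ φ xs ys = trans (cong sum (map-++ φ xs ys)) (sum-++ (map φ xs) (map φ ys))

  ∑-+ : ∀ (φ ψ : A → ℕ) xs → ∑[ x ∈ xs ] (φ x + ψ x) ≡ ∑ xs φ + ∑ xs ψ
  ∑-+ φ ψ [] = refl
  ∑-+ φ ψ (x ∷ xs) =
    trans (cong (φ x + ψ x +_) (∑-+ φ ψ xs)) (interchange (φ x) (ψ x) (∑ xs φ) (∑ xs ψ))

  ∑-*ˡ : ∀ k (φ : A → ℕ) xs → ∑[ x ∈ xs ] (k * φ x) ≡ k * ∑ xs φ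
  ∑-*ˡ k φ [] = sym (*-zeroʳ k)
  ∑-*ˡ k φ (x ∷ xs) = trans (cong (k * φ x +_) (∑-*ˡ k φ xs)) (sym (*-distribˡ-+ k (φ x) _))

  count≡∑𝟙 : ∀ (p : A → Bool) xs → count p xs ≡ ∑[ x ∈ xs ] 𝟙 (p x)
  count≡∑𝟙 p [] = refl
  count≡∑𝟙 p (x ∷ xs) with p x
  ... | true = cong suc (count≡∑𝟙 p xs)
  ... | false = count≡∑𝟙 p xs

  ∑-filterᵇ : ∀ (p : A → Bool) (φ : A → ℕ) xs → ∑ (filterᵇ p xs) φ ≡ ∑[ x ∈ xs ] (𝟙 (p x) * φ x)
  ∑-filterᵇ p φ [] = refl
  ∑-filterᵇ p φ (x ∷ xs) with p x
  ... | true = cong₂ _+_ (sym (*-identityˡ (φ x))) (∑-filterᵇ p φ xs)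
  ... | false = ∑-filterᵇ p φ xs

  count-split : ∀ (p q : A → Bool) xs →
    count p xs ≡ count (λ x → p x ∧ q x) xs + count (λ x → p x ∧ not (q x)) xs
  count-split p q xs = begin
    count p xs                                                  ≡⟨ count≡∑𝟙 p xs ⟩
    ∑[ x ∈ xs ] 𝟙 (p x)                                         ≡⟨ ∑-cong xs (λ x → 𝟙-split (p x) (q x)) ⟩
    ∑[ x ∈ xs ] (𝟙 (p x ∧ q x) + 𝟙 (p x ∧ not (q x)))           ≡⟨ ∑-+ _ _ xs ⟩
    ∑[ x ∈ xs ] 𝟙 (p x ∧ q x) + ∑[ x ∈ xs ] 𝟙 (p x ∧ not (q x)) ≡⟨ sym (cong₂ _+_ (count≡∑𝟙 _ xs) (count≡∑𝟙 _ xs)) ⟩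
    count (λ x → p x ∧ q x) xs + count (λ x → p x ∧ not (q x)) xs ∎
    where open ≡-Reasoning

  count-mono : ∀ {p q : A → Bool} xs → (∀ x → p x ≡ true → q x ≡ true) → count p xs ≤ count q xs
  count-mono {p} {q} xs p⇒q =
    subst₂ _≤_ (sym (count≡∑𝟙 p xs)) (sym (count≡∑𝟙 q xs)) (∑-mono xs (λ x → 𝟙-mono (p⇒q x)))

∑-map : ∀ {A B : Set} (h : A → B) (φ : B → ℕ) xs → ∑ (map h xs) φ ≡ ∑[ x ∈ xs ] φ (h x)
∑-map h φ xs = cong sum (sym (map-∘ xs))

∑-swap : ∀ {A B : Set} (φ : A → B → ℕ) xs ys →
  ∑[ x ∈ xs ] ∑[ y ∈ ys ] φ x y ≡ ∑[ y ∈ ys ] ∑[ x ∈ xs ] φ x y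
∑-swap φ [] ys = sym (∑-*ˡ 0 (λ _ → 0) ys)
∑-swap φ (x ∷ xs) ys = trans (cong (∑ ys (φ x) +_) (∑-swap φ xs ys)) (sym (∑-+ (φ x) _ ys))

∑-filterᵇ-count : ∀ {A B : Set} (p : A → Bool) (q : A → B → Bool) xs ys →
  ∑[ x ∈ filterᵇ p xs ] count (q x) ys ≡ ∑[ y ∈ ys ] count (λ x → p x ∧ q x y) xs
∑-filterᵇ-count p q xs ys = begin
  ∑[ x ∈ filterᵇ p xs ] count (q x) ys                    ≡⟨ ∑-filterᵇ p _ xs ⟩
  ∑[ x ∈ xs ] (𝟙 (p x) * count (q x) ys)                  ≡⟨ ∑-cong xs inner ⟩
  ∑[ x ∈ xs ] ∑[ y ∈ ys ] 𝟙 (p x ∧ q x y)                ≡⟨ ∑-swap _ xs ys ⟩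
  ∑[ y ∈ ys ] ∑[ x ∈ xs ] 𝟙 (p x ∧ q x y)                ≡⟨ ∑-cong ys (λ y → sym (count≡∑𝟙 _ xs)) ⟩
  ∑[ y ∈ ys ] count (λ x → p x ∧ q x y) xs               ∎
  where
  open ≡-Reasoning
  inner : ∀ x → 𝟙 (p x) * count (q x) ys ≡ ∑[ y ∈ ys ] 𝟙 (p x ∧ q x y)
  inner x = begin
    𝟙 (p x) * count (q x) ys             ≡⟨ cong (𝟙 (p x) *_) (count≡∑𝟙 (q x) ys) ⟩
    𝟙 (p x) * ∑[ y ∈ ys ] 𝟙 (q x y)      ≡⟨ sym (∑-*ˡ (𝟙 (p x)) _ ys) ⟩
    ∑[ y ∈ ys ] (𝟙 (p x) * 𝟙 (q x y))    ≡⟨ ∑-cong ys (λ y → sym (𝟙-∧ (p x) (q x y))) ⟩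
    ∑[ y ∈ ys ] 𝟙 (p x ∧ q x y)          ∎

_⪯ᵇ_ : ∀ {n} → Cube n → Cube n → Bool
y ⪯ᵇ x = does (y ⪯? x)

⪯ᵇ⇒⪯ : ∀ {n} {y x : Cube n} → y ⪯ᵇ x ≡ true → y ⪯ x
⪯ᵇ⇒⪯ {y = y} {x} y⪯ᵇx with y ⪯? x
... | yes y⪯x = y⪯x
⪯ᵇ⇒⪯ () | no _

⊕-self : ∀ {n} (a : Cube n) → a ⊕ a ≡ 𝟎
⊕-self [] = refl
⊕-self (b ∷ a) = cong₂ _∷_ (xor-same b) (⊕-self a)

⊕-cancelʳ : ∀ {n} (z a : Cube n) → (z ⊕ a) ⊕ a ≡ z
⊕-cancelʳ z a = begin
  (z ⊕ a) ⊕ a  ≡⟨ zipWith-assoc xor-assoc z a a ⟩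
  z ⊕ (a ⊕ a)  ≡⟨ cong (z ⊕_) (⊕-self a) ⟩
  z ⊕ 𝟎        ≡⟨ zipWith-identityʳ xor-identityʳ z ⟩
  z            ∎
  where open ≡-Reasoning

⊕-cancelˡ : ∀ {n} (a z : Cube n) → a ⊕ (a ⊕ z) ≡ z
⊕-cancelˡ a z = begin
  a ⊕ (a ⊕ z)  ≡⟨ sym (zipWith-assoc xor-assoc a a z) ⟩
  (a ⊕ a) ⊕ z  ≡⟨ cong (_⊕ z) (⊕-self a) ⟩
  𝟎 ⊕ z        ≡⟨ zipWith-identityˡ xor-identityˡ z ⟩
  z            ∎
  where open ≡-Reasoning

xor-≤ : ∀ {a b x} → a Bool.≤ x → b Bool.≤ x → (a xor b) Bool.≤ x
xor-≤ {false} {false} _ _ = ≤-minimum _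
xor-≤ {false} {true} _ b≤x = b≤x
xor-≤ {true} {false} a≤x _ = a≤x
xor-≤ {true} {true} _ _ = ≤-minimum _

⊕-⪯ : ∀ {n} {a b x : Cube n} → a ⪯ x → b ⪯ x → (a ⊕ b) ⪯ x
⊕-⪯ [] [] = []
⊕-⪯ (a≤x ∷ a⪯x) (b≤x ∷ b⪯x) = xor-≤ a≤x b≤x ∷ ⊕-⪯ a⪯x b⪯x

∈-allVecs : ∀ {n} (v : Cube n) → v ∈ allVecs n
∈-allVecs [] = here refl
∈-allVecs (false ∷ v) = ∈-++⁺ˡ (∈-map⁺ (false ∷_) (∈-allVecs v))
∈-allVecs {suc n} (true ∷ v) = ∈-++⁺ʳ (map (false ∷_) (allVecs n)) (∈-map⁺ (true ∷_) (∈-allVecs v))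

¬∀⇒∃¬ : ∀ {n} {P : Cube n → Set} → Decidable P → ¬ (∀ v → P v) → ∃ λ v → ¬ P v
¬∀⇒∃¬ {n} P? ¬∀P with any? (¬? ∘ P?) (allVecs n)
... | yes ∃¬P = satisfied ∃¬P
... | no ∄¬P = contradiction (λ v → decidable-stable (P? v) (∄¬P ∘ lose (∈-allVecs v))) ¬∀P

∑-allVecs-suc : ∀ {n} (φ : Cube (suc n) → ℕ) →
  ∑ (allVecs (suc n)) φ ≡ ∑[ z ∈ allVecs n ] φ (false ∷ z) + ∑[ z ∈ allVecs n ] φ (true ∷ z)
∑-allVecs-suc {n} φ =
  trans (∑-++ φ (map (false ∷_) (allVecs n)) _) (cong₂ _+_ (∑-map _ φ (allVecs n)) (∑-map _ φ (allVecs n)))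

∑-translate : ∀ n (φ : Cube n → ℕ) (a : Cube n) → ∑[ z ∈ allVecs n ] φ (z ⊕ a) ≡ ∑ (allVecs n) φ
∑-translate zero φ [] = refl
∑-translate (suc n) φ (b ∷ a) = begin
  ∑[ z ∈ allVecs (suc n) ] φ (z ⊕ (b ∷ a))
    ≡⟨ ∑-allVecs-suc (λ z → φ (z ⊕ (b ∷ a))) ⟩
  ∑[ z ∈ allVecs n ] φ (b ∷ (z ⊕ a)) + ∑[ z ∈ allVecs n ] φ (not b ∷ (z ⊕ a))
    ≡⟨ cong₂ _+_ (∑-translate n _ a) (∑-translate n _ a) ⟩
  ∑[ z ∈ allVecs n ] φ (b ∷ z) + ∑[ z ∈ allVecs n ] φ (not b ∷ z)
    ≡⟨ halves b ⟩
  ∑[ z ∈ allVecs n ] φ (false ∷ z) + ∑[ z ∈ allVecs n ] φ (true ∷ z)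
    ≡⟨ sym (∑-allVecs-suc φ) ⟩
  ∑ (allVecs (suc n)) φ ∎
  where
  open ≡-Reasoning
  halves : ∀ b → ∑[ z ∈ allVecs n ] φ (b ∷ z) + ∑[ z ∈ allVecs n ] φ (not b ∷ z)
               ≡ ∑[ z ∈ allVecs n ] φ (false ∷ z) + ∑[ z ∈ allVecs n ] φ (true ∷ z)
  halves false = refl
  halves true = +-comm (∑[ z ∈ allVecs n ] φ (true ∷ z)) _

count-translate : ∀ n (p : Cube n → Bool) (a : Cube n) →
  count (λ z → p (z ⊕ a)) (allVecs n) ≡ count p (allVecs n)
count-translate n p a =
  trans (count≡∑𝟙 _ (allVecs n)) (trans (∑-translate n (𝟙 ∘ p) a) (sym (count≡∑𝟙 p (allVecs n))))

⊕-closedᵇ : ∀ {n} → (Cube n → Bool) → Set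
⊕-closedᵇ {n} h = ∀ (a b : Cube n) → h a ≡ true → h b ≡ true → h (a ⊕ b) ≡ true

⪯ᵇ-⊕-closed : ∀ {n} (x : Cube n) → ⊕-closedᵇ (_⪯ᵇ x)
⪯ᵇ-⊕-closed x a b a⪯x b⪯x = dec-true ((a ⊕ b) ⪯? x) (⊕-⪯ (⪯ᵇ⇒⪯ a⪯x) (⪯ᵇ⇒⪯ b⪯x))

module _ {n : ℕ} (d h : Cube n → Bool)
         (d-closed : ⊕-closedᵇ d) (h-closed : ⊕-closedᵇ h)
         (c : Cube n) (dc : d c ≡ true) (hc : h c ≡ false) where

  translate-into-complement : ∀ z → d (z ⊕ c) ∧ h (z ⊕ c) ≡ true → d z ∧ not (h z) ≡ true
  translate-into-complement z dh with d (z ⊕ c) in dzc | h (z ⊕ c) in hzc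
  ... | true | true = cong₂ _∧_ dz (cong not hz)
    where
    dz : d z ≡ true
    dz = subst (λ w → d w ≡ true) (⊕-cancelʳ z c) (d-closed (z ⊕ c) c dzc dc)
    hz : h z ≡ false
    hz = ¬-not λ hz → not-¬ hc (subst (λ w → h w ≡ true) (⊕-cancelˡ z c) (h-closed z (z ⊕ c) hz hzc))

  count-∧≤count-∧¬ : count (λ z → d z ∧ h z) (allVecs n) ≤ count (λ z → d z ∧ not (h z)) (allVecs n)
  count-∧≤count-∧¬ =
    subst (_≤ _) (count-translate n (λ z → d z ∧ h z) c) (count-mono (allVecs n) translate-into-complement)

  count≤2*count-∧¬ : count d (allVecs n) ≤ 2 * count (λ z → d z ∧ not (h z)) (allVecs n)
  count≤2*count-∧¬ = begin
    count d A                                     ≡⟨ count-split d h A ⟩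
    count (λ z → d z ∧ h z) A + count d∖h A      ≤⟨ +-monoˡ-≤ (count d∖h A) count-∧≤count-∧¬ ⟩
    count d∖h A + count d∖h A                     ≡⟨ cong (count d∖h A +_) (sym (+-identityʳ _)) ⟩
    2 * count d∖h A                               ∎
    where
    open ≤-Reasoning
    A = allVecs n
    d∖h : Cube n → Bool
    d∖h z = d z ∧ not (h z)

belowOutside : ∀ {n} → (Cube n → Bool) → Cube n → ℕ
belowOutside {n} h x = count (λ y → y ⪯ᵇ x ∧ not (h y)) (allVecs n)

downSize≤2*belowOutside : ∀ {n} (h : Cube n → Bool) → ⊕-closedᵇ h → ∀ {x y : Cube n} → y ⪯ x → h y ≡ false →
  downSize x ≤ 2 * belowOutside h x
downSize≤2*belowOutside h h-closed {x} {y} y⪯x hy =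
  count≤2*count-∧¬ (_⪯ᵇ x) h (⪯ᵇ-⊕-closed x) h-closed y (dec-true (y ⪯? x) y⪯x) hy

∃⪯-counterexample : ∀ {n} (h : Cube n → Bool) (x : Cube n) →
  ¬ (∀ y → y ⪯ x → h y ≡ true) → ∃ λ y → y ⪯ x × h y ≡ false
∃⪯-counterexample h x ¬↓x⊆h with ¬∀⇒∃¬ (λ y → (y ⪯? x) →-dec (h y Bool.≟ true)) ¬↓x⊆h
... | y , y∉ = y , y⪯x , ¬-not λ hy → y∉ λ _ → hy
  where
  y⪯x : y ⪯ x
  y⪯x = decidable-stable (y ⪯? x) λ y⋠x → y∉ λ y⪯x → contradiction y⪯x y⋠x

misses : ∀ {n} → (Cube n → Bool) → Cube n → ℕ
misses {n} f a = count (λ x → f x ∧ not (f (a ⊕ x))) (allVecs n)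

∉G⇒sizeF≤2*misses : ∀ {n} (f : Cube n → Bool) a → g f a ≡ false → sizeF f ≤ 2 * misses f a
∉G⇒sizeF≤2*misses {n} f a a∉G = begin
  sizeF f                       ≡⟨ count-split f (λ x → f (a ⊕ x)) (allVecs n) ⟩
  hits f a + misses f a         ≤⟨ +-monoˡ-≤ (misses f a) (<⇒≤ hits<misses) ⟩
  misses f a + misses f a       ≡⟨ cong (misses f a +_) (sym (+-identityʳ _)) ⟩
  2 * misses f a                ∎
  where
  open ≤-Reasoning
  2*hits<sizeF : 2 * hits f a < sizeF f
  2*hits<sizeF = ≰⇒> λ sizeF≤2*hits → subst Bool.T a∉G (≤⇒≤ᵇ sizeF≤2*hits)
  hits<misses : hits f a < misses f a
  hits<misses = +-cancelˡ-< (hits f a) _ _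
    (subst₂ _<_ (cong (hits f a +_) (+-identityʳ _)) (count-split f (λ x → f (a ⊕ x)) (allVecs n)) 2*hits<sizeF)

badPairs≡∑ : ∀ {n} (f : Cube n → Bool) (x : Cube n) →
  badPairs f x ≡ ∑[ y ∈ allVecs n ] count (λ u → f u ∧ (y ⪯ᵇ x ∧ not (f (y ⊕ u)))) (allVecs n)
badPairs≡∑ {n} f x = ∑-filterᵇ-count f (λ u y → y ⪯ᵇ x ∧ not (f (y ⊕ u))) (allVecs n) (allVecs n)

sizeF*belowOutside≤2*badPairs : ∀ {n} (f : Cube n → Bool) (x : Cube n) →
  sizeF f * belowOutside (g f) x ≤ 2 * badPairs f x
sizeF*belowOutside≤2*badPairs {n} f x = begin
  sizeF f * belowOutside (g f) x                  ≡⟨ cong (sizeF f *_) (count≡∑𝟙 _ A) ⟩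
  sizeF f * ∑[ y ∈ A ] 𝟙 (y ⪯ᵇ x ∧ not (g f y))    ≡⟨ sym (∑-*ˡ (sizeF f) _ A) ⟩
  ∑[ y ∈ A ] (sizeF f * 𝟙 (y ⪯ᵇ x ∧ not (g f y)))  ≤⟨ ∑-mono A bad-at ⟩
  ∑[ y ∈ A ] (2 * bad y)                          ≡⟨ ∑-*ˡ 2 bad A ⟩
  2 * ∑ A bad                                     ≡⟨ cong (2 *_) (sym (badPairs≡∑ f x)) ⟩
  2 * badPairs f x                                ∎
  where
  open ≤-Reasoning
  A = allVecs n
  bad : Cube n → ℕ
  bad y = count (λ u → f u ∧ (y ⪯ᵇ x ∧ not (f (y ⊕ u)))) A
  bad-at : ∀ y → sizeF f * 𝟙 (y ⪯ᵇ x ∧ not (g f y)) ≤ 2 * bad y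
  bad-at y with y ⪯ᵇ x | g f y in y∉G
  ... | false | _ = ≤-trans (≤-reflexive (*-zeroʳ (sizeF f))) z≤n
  ... | true | true = ≤-trans (≤-reflexive (*-zeroʳ (sizeF f))) z≤n
  ... | true | false = ≤-trans (≤-reflexive (*-identityʳ (sizeF f))) (∉G⇒sizeF≤2*misses f y y∉G)

claim3p15 : (n : ℕ) (f : Cube n → Bool) →
    (∃ λ x → f x ≡ true) →
    IsSubspace (InG f) →
    ¬ AntiMonotone (g f) →
    (x : Cube n) → InG f x → ¬ Inᵡ f x →
    sizeF f * downSize x ≤ 4 * badPairs f x
claim3p15 n f _ (_ , G-closed) _ x x∈G x∉𝒳
  with y₀ , y₀⪯x , y₀∉G ← ∃⪯-counterexample (g f) x (λ ↓x⊆G → x∉𝒳 (x∈G , ↓x⊆G)) = begin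
  sizeF f * downSize x                  ≤⟨ *-monoʳ-≤ (sizeF f) (downSize≤2*belowOutside (g f) G-closed y₀⪯x y₀∉G) ⟩
  sizeF f * (2 * belowOutside (g f) x)  ≡⟨ x∙yz≈y∙xz (sizeF f) 2 (belowOutside (g f) x) ⟩
  2 * (sizeF f * belowOutside (g f) x)  ≤⟨ *-monoʳ-≤ 2 (sizeF*belowOutside≤2*badPairs f x) ⟩
  2 * (2 * badPairs f x)                ≡⟨ sym (*-assoc 2 2 (badPairs f x)) ⟩
  4 * badPairs f x                      ∎
  where open ≤-Reasoning
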